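{- For all $n\geq 3$, the number $C_n(123,132)$ of cyclic permutations of length $n$ avoiding both patterns $123$ and $132$ equals $2^{\lfloor (n-1)/2\rfloor}$.
   Context: A permutation of length $n$ is a linear order $p=p_1p_2\cdots p_n$ of $[n]=\{1,\dots,n\}$, also viewed as the bijection $i\mapsto p_i$. It is cyclic if, as a bijection of $[n]$, it consists of a single cycle of length $n$. A permutation $p$ contains a pattern $q=q_1\cdots q_k$ if there are indices $i_1<\cdots<i_k$ such that for all $j,r$, $q_j<q_r$ iff $p_{i_j}<p_{i_r}$; otherwise $p$ avoids $q$. -}

module Defs where

open import Data.Nat using (ℕ; zero; suc; _<_)
open import Data.Fin using (Fin) renaming (_<_ to _<ᶠ_)
open import Data.Vec using (Vec; lookup)
open import Data.Product using (∃; _×_; Σ)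
open import Data.List using (List)
open import Data.List.Membership.Propositional using (_∈_)
open import Data.List.Relation.Unary.Unique.Propositional using (Unique)
open import Function.Definitions using (Injective)
open import Relation.Binary.PropositionalEquality using (_≡_)
open import Relation.Nullary using (¬_)

-- A permutation of length n in one-line notation p = p_1 ... p_n,
-- values in [n] represented as Fin n (0-based), viewed as the map i ↦ p_i.
Word : ℕ → Set
Word n = Vec (Fin n) n

app : ∀ {n} → Word n → Fin n → Fin n
app p i = lookup p i

IsPerm : ∀ {n} → Word n → Set
IsPerm {n} p = Injective _≡_ _≡_ (app p)

iter : ∀ {n} → Word n → ℕ → Fin n → Fin n
iter p zero    i = i
iter p (suc m) i = app p (iter p m i)

-- As a bijection of [n], p is a single cycle of length n:
-- every element lies in the orbit of every other (equivalently the
-- permutation group generated by p acts transitively).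
IsCyclic : ∀ {n} → Word n → Set
IsCyclic {n} p = IsPerm p × (∀ (i j : Fin n) → ∃ λ m → iter p m i ≡ j)

Contains : ∀ {n k} → Vec (Fin n) n → Vec (Fin k) k → Set
Contains {n} {k} p q =
  Σ (Fin k → Fin n) λ ι →
    (∀ (a b : Fin k) → a <ᶠ b → ι a <ᶠ ι b) ×
    (∀ (a b : Fin k) →
       ((lookup q a <ᶠ lookup q b) → (lookup p (ι a) <ᶠ lookup p (ι b))) ×
       ((lookup p (ι a) <ᶠ lookup p (ι b)) → (lookup q a <ᶠ lookup q b)))

Avoids : ∀ {n k} → Vec (Fin n) n → Vec (Fin k) k → Set
Avoids p q = ¬ Contains p q

Enumerates : ∀ {n} → (Word n → Set) → List (Word n) → Set
Enumerates {n} P L = Unique L × (∀ (p : Word n) → (p ∈ L → P p) × (P p → p ∈ L))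

module Submission where

-- A permutation avoids both 123 and 132 exactly when it has no "double rise": no entry
-- is followed by two larger entries.  Call a cyclic permutation without double rise
-- admissible.  In an admissible permutation of length N ≥ 3 the first entry is one of
-- the two largest values and the value 0 sits at one of the last two positions, and the
-- two choices are crossed (first entry N-1 and 0 at position N-2, or first entry N-2
-- and 0 at position N-1), since otherwise 0 and the position of 0 form a 2-cycle.
--
-- Deleting the first position and the value 0 contracts the path
-- x ↦ (position of 0) ↦ 0 ↦ (first entry) of the cycle to a single step and leaves an
-- admissible permutation of length N-2.  Conversely, every admissible permutation of
-- length N-2 extends in exactly one way to each crossed shape.

open import Defs
open import Data.Nat as ℕ using (ℕ; zero; suc; z≤n; s≤s; _+_; _^_; _/_; _∸_; _≤_)
import Data.Nat.Properties as ℕP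
open import Data.Nat.DivMod using (m/n≡1+[m∸n]/n)
open import Data.Fin using (Fin; zero; suc; toℕ; punchIn; punchOut; inject₁; fromℕ; _≟_)
  renaming (_<_ to _<ᶠ_)
open import Data.Fin.Properties
  using (<-cmp; <-trans; <-irrefl; <-asym; ≤∧≢⇒<; 0≢1+n; suc-injective; punchIn-injective; punchInᵢ≢i; punchIn-mono-≤;
         punchIn-cancel-≤; punchIn-punchOut; punchOut-punchIn; punchOut-cong)
open import Data.Vec using (Vec; []; _∷_; lookup; tabulate)
open import Data.Vec.Properties using (lookup∘tabulate; tabulate∘lookup; tabulate-cong)
open import Data.List using (List; []; _∷_; map; _++_; length)
open import Data.List.Properties using (length-++; length-map)
open import Data.List.Membership.Propositional using (_∈_)
open import Data.List.Membership.Propositional.Properties using (∈-map⁺; ∈-map⁻; ∈-++⁺ˡ; ∈-++⁺ʳ; ∈-++⁻)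
open import Data.List.Relation.Unary.Unique.Propositional using (Unique)
open import Data.List.Relation.Unary.Unique.Propositional.Properties using (map⁺; ++⁺)
open import Data.List.Relation.Unary.Any using (here; there)
import Data.List.Relation.Unary.All as All
import Data.List.Relation.Unary.AllPairs as AllPairs
open import Data.Product using (∃; _×_; _,_; proj₁; proj₂)
open import Data.Sum using (_⊎_; inj₁; inj₂)
import Data.Sum as Sum
open import Data.Empty using (⊥; ⊥-elim)
open import Function using (_∘_)
open import Relation.Binary.PropositionalEquality
open import Relation.Binary.Definitions using (tri<; tri≈; tri>)
open import Relation.Nullary using (¬_; yes; no)

pattern123 : Vec (Fin 3) 3
pattern123 = zero ∷ suc zero ∷ suc (suc zero) ∷ []

pattern132 : Vec (Fin 3) 3
pattern132 = zero ∷ suc (suc zero) ∷ suc zero ∷ []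

-- Both patterns are involutions of {0,1,2}; this is what the occurrence lemma needs.
involutive123 : ∀ a → lookup pattern123 (lookup pattern123 a) ≡ a
involutive123 zero = refl
involutive123 (suc zero) = refl
involutive123 (suc (suc zero)) = refl

involutive132 : ∀ a → lookup pattern132 (lookup pattern132 a) ≡ a
involutive132 zero = refl
involutive132 (suc zero) = refl
involutive132 (suc (suc zero)) = refl

NoDoubleRise : ∀ {n} → Word n → Set
NoDoubleRise {n} p = ∀ (i j k : Fin n) → i <ᶠ j → j <ᶠ k →
  app p i <ᶠ app p j → app p i <ᶠ app p k → ⊥

triple : ∀ {n} → Fin n → Fin n → Fin n → Fin 3 → Fin n
triple i j k zero = i
triple i j k (suc zero) = j
triple i j k (suc (suc zero)) = k

increasing3 : ∀ {n} (f : Fin 3 → Fin n) → f zero <ᶠ f (suc zero) → f (suc zero) <ᶠ f (suc (suc zero)) →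
  ∀ a b → a <ᶠ b → f a <ᶠ f b
increasing3 f f01 f12 zero (suc zero) _ = f01
increasing3 f f01 f12 zero (suc (suc zero)) _ = <-trans f01 f12
increasing3 f f01 f12 (suc zero) (suc (suc zero)) _ = f12
increasing3 f f01 f12 zero zero ()
increasing3 f f01 f12 (suc zero) zero ()
increasing3 f f01 f12 (suc zero) (suc zero) (s≤s ())
increasing3 f f01 f12 (suc (suc zero)) zero ()
increasing3 f f01 f12 (suc (suc zero)) (suc zero) (s≤s ())
increasing3 f f01 f12 (suc (suc zero)) (suc (suc zero)) (s≤s (s≤s ()))

reflects : ∀ {k n} (q : Vec (Fin k) k) (r : Fin k → Fin n) →
  (∀ a b → lookup q a ≡ lookup q b → a ≡ b) →
  (∀ a b → lookup q a <ᶠ lookup q b → r a <ᶠ r b) →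
  ∀ a b → r a <ᶠ r b → lookup q a <ᶠ lookup q b
reflects q r q-inj preserves a b ra<rb with <-cmp (lookup q a) (lookup q b)
... | tri< qa<qb _ _ = qa<qb
... | tri≈ _ qa≡qb _ rewrite q-inj a b qa≡qb = ⊥-elim (<-irrefl refl ra<rb)
... | tri> _ _ qb<qa = ⊥-elim (<-asym ra<rb (preserves b a qb<qa))

entries : ∀ {n} → Word n → Fin n → Fin n → Fin n → Fin 3 → Fin n
entries p i j k = app p ∘ triple i j k

occurrence : ∀ {n} (p : Word n) (q : Vec (Fin 3) 3) → (∀ a → lookup q (lookup q a) ≡ a) →
  ∀ {i j k} → i <ᶠ j → j <ᶠ k →
  entries p i j k (lookup q zero) <ᶠ entries p i j k (lookup q (suc zero)) →
  entries p i j k (lookup q (suc zero)) <ᶠ entries p i j k (lookup q (suc (suc zero))) →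
  Contains p q
occurrence p q involutive {i} {j} {k} i<j j<k r01 r12 =
  triple i j k , increasing3 (triple i j k) i<j j<k ,
  λ a b → preserves a b , reflects q r q-injective preserves a b
  where
  r : Fin 3 → Fin _
  r = entries p i j k
  q-injective : ∀ a b → lookup q a ≡ lookup q b → a ≡ b
  q-injective a b e = trans (sym (involutive a)) (trans (cong (lookup q) e) (involutive b))
  preserves : ∀ a b → lookup q a <ᶠ lookup q b → r a <ᶠ r b
  preserves a b lt = subst₂ (λ x y → r x <ᶠ r y) (involutive a) (involutive b)
    (increasing3 (r ∘ lookup q) r01 r12 _ _ lt)

avoids⇒noDoubleRise : ∀ {n} (p : Word n) → IsPerm p →
  Avoids p pattern123 → Avoids p pattern132 → NoDoubleRise p
avoids⇒noDoubleRise p perm avoid123 avoid132 i j k i<j j<k pi<pj pi<pk with <-cmp (app p j) (app p k)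
... | tri< pj<pk _ _ = avoid123 (occurrence p pattern123 involutive123 i<j j<k pi<pj pj<pk)
... | tri≈ _ pj≡pk _ = <-irrefl (perm pj≡pk) j<k
... | tri> _ _ pk<pj = avoid132 (occurrence p pattern132 involutive132 i<j j<k pi<pk pk<pj)

noDoubleRise⇒avoids : ∀ {n} (p : Word n) (q : Vec (Fin 3) 3) →
  lookup q zero <ᶠ lookup q (suc zero) → lookup q zero <ᶠ lookup q (suc (suc zero)) →
  NoDoubleRise p → Avoids p q
noDoubleRise⇒avoids p q q01 q02 noRise (ι , ι-increasing , sameOrder) =
  noRise (ι zero) (ι (suc zero)) (ι (suc (suc zero)))
    (ι-increasing zero (suc zero) (s≤s z≤n)) (ι-increasing (suc zero) (suc (suc zero)) (s≤s (s≤s z≤n)))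
    (proj₁ (sameOrder zero (suc zero)) q01) (proj₁ (sameOrder zero (suc (suc zero))) q02)

noDoubleRise-two-later : ∀ {n} (p : Word n) → NoDoubleRise p → ∀ {i j k} →
  i <ᶠ j → i <ᶠ k → j ≢ k → app p i <ᶠ app p j → app p i <ᶠ app p k → ⊥
noDoubleRise-two-later p noRise {j = j} {k} i<j i<k j≢k pi<pj pi<pk with <-cmp j k
... | tri< j<k _ _ = noRise _ j k i<j j<k pi<pj pi<pk
... | tri≈ _ j≡k _ = j≢k j≡k
... | tri> _ _ k<j = noRise _ k j i<k k<j pi<pk pi<pj

Reach : ∀ {n} → Word n → Fin n → Fin n → Set
Reach p i j = ∃ λ k → iter p k i ≡ j

iter-+ : ∀ {n} (p : Word n) a b i → iter p (b + a) i ≡ iter p b (iter p a i)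
iter-+ p a zero i = refl
iter-+ p a (suc b) i = cong (app p) (iter-+ p a b i)

iter-suc : ∀ {n} (p : Word n) k i → iter p (suc k) i ≡ iter p k (app p i)
iter-suc p zero i = refl
iter-suc p (suc k) i = cong (app p) (iter-suc p k i)

reach-refl : ∀ {n} (p : Word n) i → Reach p i i
reach-refl p i = 0 , refl

reach-step : ∀ {n} (p : Word n) {i j} → app p i ≡ j → Reach p i j
reach-step p e = 1 , e

reach-trans : ∀ {n} (p : Word n) {i j l} → Reach p i j → Reach p j l → Reach p i l
reach-trans p {i} (a , ea) (b , eb) = b + a , trans (iter-+ p a b i) (trans (cong (iter p b) ea) eb)

cyclic-surjective : ∀ {n} (p : Word n) → IsCyclic p → ∀ y → ∃ λ x → app p x ≡ y
cyclic-surjective p (_ , connected) y with connected (app p y) y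
... | zero , e = y , e
... | suc k , e = iter p k (app p y) , e

cyclic-no-2-cycle : ∀ {n} (p : Word n) x y z → app p x ≡ y → app p y ≡ x → z ≢ x → z ≢ y → ¬ IsCyclic p
cyclic-no-2-cycle p x y z px≡y py≡x z≢x z≢y (_ , connected) = unreachable (connected x z)
  where
  orbit : ∀ k → (iter p k x ≡ x) ⊎ (iter p k x ≡ y)
  orbit zero = inj₁ refl
  orbit (suc k) with orbit k
  ... | inj₁ e = inj₂ (trans (cong (app p) e) px≡y)
  ... | inj₂ e = inj₁ (trans (cong (app p) e) py≡x)
  unreachable : Reach p x z → ⊥
  unreachable (k , e) with orbit k
  ... | inj₁ e' = z≢x (trans (sym e) e')
  ... | inj₂ e' = z≢y (trans (sym e) e')

punchIn-mono-< : ∀ {n} (i : Fin (suc n)) (x y : Fin n) → x <ᶠ y → punchIn i x <ᶠ punchIn i y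
punchIn-mono-< i x y x<y = ℕP.≰⇒> (λ le → ℕP.<⇒≱ x<y (punchIn-cancel-≤ i y x le))

punchIn-cancel-< : ∀ {n} (i : Fin (suc n)) (x y : Fin n) → punchIn i x <ᶠ punchIn i y → x <ᶠ y
punchIn-cancel-< i x y lt = ℕP.≰⇒> (λ le → ℕP.<⇒≱ lt (punchIn-mono-≤ i y x le))

lookup-ext : ∀ {A : Set} {k} (u w : Vec A k) → (∀ i → lookup u i ≡ lookup w i) → u ≡ w
lookup-ext u w h = trans (sym (tabulate∘lookup u)) (trans (tabulate-cong h) (tabulate∘lookup w))

AtMostOneAbove : ∀ {n} → Fin n → Set
AtMostOneAbove {n} a = ∀ (y z : Fin n) → a <ᶠ y → a <ᶠ z → y ≡ z

-- For insertion points qa ra : Fin (1+n), a word p of length n is extended to a word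
-- p' of length 2+n by a new first position 0 and a new smallest value 0: old position
-- x becomes 1+Q x and old value v becomes 1+R v (Q, R punch holes at qa, ra), and the
-- new points go 0 ↦ 1+ra and 1+qa ↦ 0.

module Insertion {n : ℕ} (qa ra : Fin (suc n)) where

  Q R : Fin n → Fin (suc n)
  Q = punchIn qa
  R = punchIn ra

  record Inserts (p : Word n) (p' : Word (suc (suc n))) : Set where
    constructor inserts
    field
      old-step   : ∀ x → app p' (suc (Q x)) ≡ suc (R (app p x))
      first-step : app p' zero ≡ suc ra
      hole-step  : app p' (suc qa) ≡ zero

  data Position : Fin (suc (suc n)) → Set where
    first : Position zero
    hole  : Position (suc qa)
    old   : ∀ x → Position (suc (Q x))

  position : ∀ y → Position y
  position zero = first
  position (suc y) with qa ≟ y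
  ... | yes refl = hole
  ... | no qa≢y = subst (Position ∘ suc) (punchIn-punchOut qa≢y) (old (punchOut qa≢y))

  inserted : Word n → Fin (suc (suc n)) → Fin (suc (suc n))
  inserted p zero = suc ra
  inserted p (suc y) with qa ≟ y
  ... | yes _ = zero
  ... | no qa≢y = suc (R (app p (punchOut qa≢y)))

  insert : Word n → Word (suc (suc n))
  insert p = tabulate (inserted p)

  insert-inserts : ∀ p → Inserts p (insert p)
  insert-inserts p = inserts
    (λ x → trans (lookup∘tabulate (inserted p) (suc (Q x))) (at-old x))
    (lookup∘tabulate (inserted p) zero)
    (trans (lookup∘tabulate (inserted p) (suc qa)) at-hole)
    where
    at-old : ∀ x → inserted p (suc (Q x)) ≡ suc (R (app p x))
    at-old x with qa ≟ Q x
    ... | yes qa≡Qx = ⊥-elim (punchInᵢ≢i qa x (sym qa≡Qx))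
    ... | no _ = cong (suc ∘ R ∘ app p) (trans (punchOut-cong qa refl) (punchOut-punchIn qa))
    at-hole : inserted p (suc qa) ≡ zero
    at-hole with qa ≟ qa
    ... | yes _ = refl
    ... | no qa≢qa = ⊥-elim (qa≢qa refl)

  inserts-functional : ∀ {p p₁ p₂} → Inserts p p₁ → Inserts p p₂ → p₁ ≡ p₂
  inserts-functional {_} {p₁} {p₂} (inserts old₁ first₁ hole₁) (inserts old₂ first₂ hole₂) =
    lookup-ext p₁ p₂ (λ y → agree (position y))
    where
    agree : ∀ {y} → Position y → app p₁ y ≡ app p₂ y
    agree first = trans first₁ (sym first₂)
    agree hole = trans hole₁ (sym hole₂)
    agree (old x) = trans (old₁ x) (sym (old₂ x))

  inserts-injective : ∀ {p₁ p₂ p'} → Inserts p₁ p' → Inserts p₂ p' → p₁ ≡ p₂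
  inserts-injective {p₁} {p₂} (inserts old₁ _ _) (inserts old₂ _ _) = lookup-ext p₁ p₂
    (λ x → punchIn-injective ra _ _ (suc-injective (trans (sym (old₁ x)) (old₂ x))))

  insert-injective : ∀ {p₁ p₂} → insert p₁ ≡ insert p₂ → p₁ ≡ p₂
  insert-injective {p₁} {p₂} e =
    inserts-injective (insert-inserts p₁) (subst (Inserts p₂) (sym e) (insert-inserts p₂))

  extract : ∀ p' → IsPerm p' → app p' zero ≡ suc ra → app p' (suc qa) ≡ zero →
    ∃ λ p → Inserts p p'
  extract p' perm p'-first p'-hole =
    tabulate (proj₁ ∘ old-value) ,
    inserts (λ x → trans (sym (proj₂ (old-value x))) (cong (suc ∘ R) (sym (lookup∘tabulate _ x))))
      p'-first p'-hole
    where
    unpunch : ∀ w → w ≢ zero → w ≢ suc ra → ∃ λ v → suc (R v) ≡ w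
    unpunch zero w≢0 _ = ⊥-elim (w≢0 refl)
    unpunch (suc w) _ w≢ra = punchOut ra≢w , cong suc (punchIn-punchOut ra≢w)
      where
      ra≢w : ra ≢ w
      ra≢w e = w≢ra (cong suc (sym e))
    old-value : ∀ x → ∃ λ v → suc (R v) ≡ app p' (suc (Q x))
    old-value x = unpunch (app p' (suc (Q x)))
      (λ e → punchInᵢ≢i qa x (suc-injective (perm (trans e (sym p'-hole)))))
      (λ e → 0≢1+n (sym (perm (trans e (sym p'-first)))))

  perm-down : ∀ {p p'} → Inserts p p' → IsPerm p' → IsPerm p
  perm-down (inserts old-step _ _) perm {x} {y} px≡py =
    punchIn-injective qa x y (suc-injective (perm (trans (old-step x)
      (trans (cong (suc ∘ R) px≡py) (sym (old-step y))))))

  perm-up : ∀ {p p'} → Inserts p p' → IsPerm p → IsPerm p'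
  perm-up {p} {p'} (inserts old-step first-step hole-step) perm {i} {j} = injective (position i) (position j)
    where
    first≢old : ∀ x → app p' zero ≢ app p' (suc (Q x))
    first≢old x e = punchInᵢ≢i ra (app p x) (sym (suc-injective (trans (sym first-step) (trans e (old-step x)))))
    hole≢old : ∀ x → app p' (suc qa) ≢ app p' (suc (Q x))
    hole≢old x e = 0≢1+n (trans (sym hole-step) (trans e (old-step x)))
    first≢hole : app p' zero ≢ app p' (suc qa)
    first≢hole e = 0≢1+n (sym (trans (sym first-step) (trans e hole-step)))
    injective : ∀ {i j} → Position i → Position j → app p' i ≡ app p' j → i ≡ j
    injective first first _ = refl
    injective first hole e = ⊥-elim (first≢hole e)
    injective first (old y) e = ⊥-elim (first≢old y e)
    injective hole first e = ⊥-elim (first≢hole (sym e))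
    injective hole hole _ = refl
    injective hole (old y) e = ⊥-elim (hole≢old y e)
    injective (old x) first e = ⊥-elim (first≢old x (sym e))
    injective (old x) hole e = ⊥-elim (hole≢old x (sym e))
    injective (old x) (old y) e = cong (suc ∘ Q)
      (perm (punchIn-injective ra _ _ (suc-injective (trans (sym (old-step x)) (trans e (old-step y))))))

  -- Q and R are increasing, so a double rise of p is one of p'.
  noDoubleRise-down : ∀ {p p'} → Inserts p p' → NoDoubleRise p' → NoDoubleRise p
  noDoubleRise-down {p} {p'} (inserts old-step _ _) noRise x y z x<y y<z px<py px<pz =
    noRise (suc (Q x)) (suc (Q y)) (suc (Q z))
      (s≤s (punchIn-mono-< qa x y x<y)) (s≤s (punchIn-mono-< qa y z y<z))
      (subst₂ _<ᶠ_ (sym (old-step x)) (sym (old-step y)) (s≤s (punchIn-mono-< ra (app p x) (app p y) px<py)))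
      (subst₂ _<ᶠ_ (sym (old-step x)) (sym (old-step z)) (s≤s (punchIn-mono-< ra (app p x) (app p z) px<pz)))

  -- If qa and ra are among the two largest points, insertion creates no double rise: a
  -- rise starting at 0 needs two values above 1+ra, one starting at 1+qa needs two
  -- positions after 1+qa, and one starting at an old position can use neither 0 (which
  -- comes first) nor 1+qa (whose value is 0), so it is a double rise of p.
  module Rises (qa-top : AtMostOneAbove qa) (ra-top : AtMostOneAbove ra) where

    noDoubleRise-up : ∀ {p p'} → Inserts p p' → IsPerm p → NoDoubleRise p → NoDoubleRise p'
    noDoubleRise-up {p} {p'} ins@(inserts old-step first-step hole-step) perm noRise i j k =
      rise (position i) (position j) (position k)
      where
      perm' : IsPerm p'
      perm' = perm-up ins perm
      above-first : ∀ v → app p' zero <ᶠ v → ∃ λ w → v ≡ suc w × ra <ᶠ w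
      above-first zero ()
      above-first (suc w) lt = w , refl , ℕ.s<s⁻¹ (subst (_<ᶠ suc w) first-step lt)
      rise : ∀ {i j k} → Position i → Position j → Position k → i <ᶠ j → j <ᶠ k →
        app p' i <ᶠ app p' j → app p' i <ᶠ app p' k → ⊥
      rise {j = j} {k} first _ _ _ j<k pi<pj pi<pk
        with above-first (app p' j) pi<pj | above-first (app p' k) pi<pk
      ... | w₁ , e₁ , ra<w₁ | w₂ , e₂ , ra<w₂ =
        <-irrefl (perm' (trans e₁ (trans (cong suc (ra-top w₁ w₂ ra<w₁ ra<w₂)) (sym e₂)))) j<k
      rise hole first _ () _ _ _
      rise hole hole _ i<j _ _ _ = ℕP.<-irrefl refl i<j
      rise hole (old y) first _ () _ _
      rise hole (old y) hole i<j j<k _ _ = ℕP.<-irrefl refl (ℕP.<-trans i<j j<k)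
      rise hole (old y) (old z) i<j j<k _ _ =
        <-irrefl (qa-top (Q y) (Q z) (ℕ.s<s⁻¹ i<j) (ℕ.s<s⁻¹ (ℕP.<-trans i<j j<k))) (ℕ.s<s⁻¹ j<k)
      rise (old x) first _ () _ _ _
      rise (old x) hole _ _ _ pi<pj _ with subst (app p' (suc (Q x)) <ᶠ_) hole-step pi<pj
      ... | ()
      rise (old x) (old y) first _ () _ _
      rise (old x) (old y) hole _ _ _ pi<pk with subst (app p' (suc (Q x)) <ᶠ_) hole-step pi<pk
      ... | ()
      rise (old x) (old y) (old z) i<j j<k pi<pj pi<pk =
        noRise x y z (punchIn-cancel-< qa x y (ℕ.s<s⁻¹ i<j)) (punchIn-cancel-< qa y z (ℕ.s<s⁻¹ j<k))
          (punchIn-cancel-< ra _ _ (ℕ.s<s⁻¹ (subst₂ _<ᶠ_ (old-step x) (old-step y) pi<pj)))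
          (punchIn-cancel-< ra _ _ (ℕ.s<s⁻¹ (subst₂ _<ᶠ_ (old-step x) (old-step z) pi<pk)))

  -- If Q and R agree except at one point s, where they are swapped (Q s = ra, R s = qa),
  -- the step x ↦ s of p becomes the path 1+Q x ↦ 1+qa ↦ 0 ↦ 1+Q s of p', and every
  -- other step x ↦ y becomes 1+Q x ↦ 1+Q y.  Hence p is cyclic iff p' is.
  module Cycles (s : Fin n) (Q≡R : ∀ x → x ≢ s → Q x ≡ R x) (Q-s : Q s ≡ ra) (R-s : R s ≡ qa)
                {p : Word n} {p' : Word (suc (suc n))} (ins : Inserts p p') where

    old-step : ∀ x → app p' (suc (Q x)) ≡ suc (R (app p x))
    old-step = Inserts.old-step ins

    first-step : app p' zero ≡ suc (Q s)
    first-step = trans (Inserts.first-step ins) (cong suc (sym Q-s))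

    hole-step : app p' (suc qa) ≡ zero
    hole-step = Inserts.hole-step ins

    step-to-hole : ∀ x → app p x ≡ s → app p' (suc (Q x)) ≡ suc qa
    step-to-hole x px≡s = trans (old-step x) (cong suc (trans (cong R px≡s) R-s))

    step-to-old : ∀ x → app p x ≢ s → app p' (suc (Q x)) ≡ suc (Q (app p x))
    step-to-old x px≢s = trans (old-step x) (cong suc (sym (Q≡R (app p x) px≢s)))

    step-up : ∀ x → Reach p' (suc (Q x)) (suc (Q (app p x)))
    step-up x with app p x ≟ s
    ... | yes px≡s = reach-trans p' (reach-step p' (step-to-hole x px≡s))
                       (reach-trans p' (reach-step p' hole-step)
                         (reach-step p' (trans first-step (cong (suc ∘ Q) (sym px≡s)))))
    ... | no px≢s = reach-step p' (step-to-old x px≢s)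

    reach-up : ∀ {x y} → Reach p x y → Reach p' (suc (Q x)) (suc (Q y))
    reach-up (zero , refl) = reach-refl p' _
    reach-up {x} (suc k , refl) = reach-trans p' (reach-up (k , refl)) (step-up (iter p k x))

    -- Every point of p' reaches 1+Q s and is reached from it.
    cyclic-up : IsCyclic p → IsCyclic p'
    cyclic-up cyc@(perm , connected) =
      perm-up ins perm , λ i j → reach-trans p' (to-hub (position i)) (from-hub (position j))
      where
      to-hub : ∀ {i} → Position i → Reach p' i (suc (Q s))
      to-hub first = reach-step p' first-step
      to-hub hole = reach-trans p' (reach-step p' hole-step) (reach-step p' first-step)
      to-hub (old x) = reach-up (connected x s)
      -- the predecessor of s on the cycle leads into the hole
      to-hole : Reach p' (suc (Q s)) (suc qa)
      to-hole with cyclic-surjective p cyc s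
      ... | x , px≡s = reach-trans p' (reach-up (connected s x)) (reach-step p' (step-to-hole x px≡s))
      from-hub : ∀ {j} → Position j → Reach p' (suc (Q s)) j
      from-hub first = reach-trans p' to-hole (reach-step p' hole-step)
      from-hub hole = to-hole
      from-hub (old y) = reach-up (connected s y)

    -- Conversely, a path of p' between old points passes 1+qa only on the way to 1+Q s.
    mutual
      reach-down : ∀ k x y → iter p' k (suc (Q x)) ≡ suc (Q y) → Reach p x y
      reach-down zero x y e = 0 , punchIn-injective qa x y (suc-injective e)
      reach-down (suc k) x y e with app p x ≟ s
      ... | no px≢s = reach-trans p (reach-step p refl) (reach-down k (app p x) y
              (trans (cong (iter p' k) (sym (step-to-old x px≢s))) (trans (sym (iter-suc p' k _)) e)))
      ... | yes px≡s = reach-trans p (reach-step p px≡s) (reach-down-from-hole k y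
              (trans (cong (iter p' k) (sym (step-to-hole x px≡s))) (trans (sym (iter-suc p' k _)) e)))

      reach-down-from-hole : ∀ k y → iter p' k (suc qa) ≡ suc (Q y) → Reach p s y
      reach-down-from-hole zero y e = ⊥-elim (punchInᵢ≢i qa y (sym (suc-injective e)))
      reach-down-from-hole (suc zero) y e = ⊥-elim (0≢1+n (trans (sym hole-step) e))
      reach-down-from-hole (suc (suc k)) y e = reach-down k s y (begin
        iter p' k (suc (Q s))                   ≡⟨ cong (iter p' k) (sym (trans (cong (app p') hole-step) first-step)) ⟩
        iter p' k (app p' (app p' (suc qa)))    ≡⟨ sym (iter-suc p' k _) ⟩
        iter p' (suc k) (app p' (suc qa))       ≡⟨ sym (iter-suc p' (suc k) _) ⟩
        iter p' (suc (suc k)) (suc qa)          ≡⟨ e ⟩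
        suc (Q y)                               ∎)
        where open ≡-Reasoning

    cyclic-down : IsCyclic p' → IsCyclic p
    cyclic-down (perm , connected) =
      perm-down ins perm ,
      λ x y → let (k , e) = connected (suc (Q x)) (suc (Q y)) in reach-down k x y e

penult last : ∀ k → Fin (suc (suc k))
penult k = inject₁ (fromℕ k)
last k = fromℕ (suc k)

penult<last : ∀ k → penult k <ᶠ last k
penult<last zero = s≤s z≤n
penult<last (suc k) = s≤s (penult<last k)

penult≢last : ∀ k → penult k ≢ last k
penult≢last k e = <-irrefl e (penult<last k)

top-cases : ∀ {k} (w : Fin (suc (suc k))) → w <ᶠ penult k ⊎ w ≡ penult k ⊎ w ≡ last k
top-cases {zero} zero = inj₂ (inj₁ refl)
top-cases {zero} (suc zero) = inj₂ (inj₂ refl)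
top-cases {suc k} zero = inj₁ (s≤s z≤n)
top-cases {suc k} (suc w) = Sum.map s≤s (Sum.map (cong suc) (cong suc)) (top-cases w)

penult-top : ∀ k → AtMostOneAbove (penult k)
penult-top k y z penult<y penult<z = trans (is-last y penult<y) (sym (is-last z penult<z))
  where
  is-last : ∀ y → penult k <ᶠ y → y ≡ last k
  is-last y penult<y with top-cases y
  ... | inj₁ y<penult = ⊥-elim (<-asym y<penult penult<y)
  ... | inj₂ (inj₁ y≡penult) = ⊥-elim (<-irrefl (sym y≡penult) penult<y)
  ... | inj₂ (inj₂ y≡last) = y≡last

last-top : ∀ k → AtMostOneAbove (last k)
last-top k y z last<y _ with top-cases y
... | inj₁ y<penult = ⊥-elim (<-asym (<-trans y<penult (penult<last k)) last<y)
... | inj₂ (inj₁ refl) = ⊥-elim (<-asym (penult<last k) last<y)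
... | inj₂ (inj₂ refl) = ⊥-elim (<-irrefl refl last<y)

punchIn-penult≡last : ∀ k (x : Fin (suc k)) → x ≢ fromℕ k → punchIn (penult k) x ≡ punchIn (last k) x
punchIn-penult≡last zero zero x≢top = ⊥-elim (x≢top refl)
punchIn-penult≡last (suc k) zero _ = refl
punchIn-penult≡last (suc k) (suc x) x≢top = cong suc (punchIn-penult≡last k x (x≢top ∘ cong suc))

punchIn-penult-top : ∀ k → punchIn (penult k) (fromℕ k) ≡ last k
punchIn-penult-top zero = refl
punchIn-penult-top (suc k) = cong suc (punchIn-penult-top k)

punchIn-last-top : ∀ k → punchIn (last k) (fromℕ k) ≡ penult k
punchIn-last-top zero = refl
punchIn-last-top (suc k) = cong suc (punchIn-last-top k)

Admissible : ∀ {n} → Word n → Set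
Admissible p = IsCyclic p × NoDoubleRise p

-- The first entry is one of the two largest values: otherwise both of them follow it.
first-entry-top : ∀ k (p : Word (suc (suc k))) → IsCyclic p → NoDoubleRise p →
  app p zero ≡ penult k ⊎ app p zero ≡ last k
first-entry-top k p cyc noRise with top-cases (app p zero)
... | inj₂ top = top
... | inj₁ p0<penult with cyclic-surjective p cyc (penult k) | cyclic-surjective p cyc (last k)
... | j , pj≡penult | l , pl≡last = ⊥-elim
  (noDoubleRise-two-later p noRise (≤∧≢⇒< z≤n (j≢0 ∘ sym)) (≤∧≢⇒< z≤n (l≢0 ∘ sym))
    (λ j≡l → penult≢last k (trans (sym pj≡penult) (trans (cong (app p) j≡l) pl≡last)))
    (subst (app p zero <ᶠ_) (sym pj≡penult) p0<penult)
    (subst (app p zero <ᶠ_) (sym pl≡last) p0<last))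
  where
  p0<last : app p zero <ᶠ last k
  p0<last = <-trans p0<penult (penult<last k)
  j≢0 : j ≢ zero
  j≢0 e = <-irrefl (trans (cong (app p) (sym e)) pj≡penult) p0<penult
  l≢0 : l ≢ zero
  l≢0 e = <-irrefl (trans (cong (app p) (sym e)) pl≡last) p0<last

-- The value 0 sits at one of the last two positions: otherwise both of them follow it.
zero-position-top : ∀ k (p : Word (suc (suc k))) → IsCyclic p → NoDoubleRise p →
  app p (penult k) ≡ zero ⊎ app p (last k) ≡ zero
zero-position-top k p cyc@(perm , _) noRise with cyclic-surjective p cyc zero
... | z , pz≡0 with top-cases z
... | inj₂ (inj₁ refl) = inj₁ pz≡0
... | inj₂ (inj₂ refl) = inj₂ pz≡0
... | inj₁ z<penult = ⊥-elim
  (noDoubleRise-two-later p noRise z<penult z<last (penult≢last k) (above z<penult) (above z<last))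
  where
  z<last : z <ᶠ last k
  z<last = <-trans z<penult (penult<last k)
  above : ∀ {j} → z <ᶠ j → app p z <ᶠ app p j
  above {j} z<j = subst (_<ᶠ app p j) (sym pz≡0)
    (≤∧≢⇒< z≤n (λ 0≡pj → <-irrefl (perm (trans pz≡0 0≡pj)) z<j))

data CrossedShape {m : ℕ} (p : Word (suc (suc (suc m)))) : Set where
  last-first   : app p zero ≡ suc (last m) → app p (suc (penult m)) ≡ zero → CrossedShape p
  penult-first : app p zero ≡ suc (penult m) → app p (suc (last m)) ≡ zero → CrossedShape p

-- The uncrossed combinations would make {0, position of 0} a 2-cycle.
crossed-shape : ∀ m (p : Word (suc (suc (suc m)))) → Admissible p → CrossedShape p
crossed-shape m p (cyc , noRise)
  with first-entry-top (suc m) p cyc noRise | zero-position-top (suc m) p cyc noRise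
... | inj₂ first≡last | inj₁ penult↦0 = last-first first≡last penult↦0
... | inj₁ first≡penult | inj₂ last↦0 = penult-first first≡penult last↦0
... | inj₂ first≡last | inj₂ last↦0 = ⊥-elim
  (cyclic-no-2-cycle p zero (last (suc m)) (penult (suc m)) first≡last last↦0 (λ ()) (penult≢last (suc m)) cyc)
... | inj₁ first≡penult | inj₁ penult↦0 = ⊥-elim
  (cyclic-no-2-cycle p zero (penult (suc m)) (last (suc m)) first≡penult penult↦0 (λ ())
    (penult≢last (suc m) ∘ sym) cyc)

module AdmissibleInsertion {m : ℕ} (qa ra : Fin (suc (suc m))) (s : Fin (suc m))
  (Q≡R : ∀ x → x ≢ s → punchIn qa x ≡ punchIn ra x) (Q-s : punchIn qa s ≡ ra) (R-s : punchIn ra s ≡ qa)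
  (qa-top : AtMostOneAbove qa) (ra-top : AtMostOneAbove ra) where

  open Insertion qa ra public

  admissible-up : ∀ {p p'} → Inserts p p' → Admissible p → Admissible p'
  admissible-up ins (cyc , noRise) =
    Cycles.cyclic-up s Q≡R Q-s R-s ins cyc , Rises.noDoubleRise-up qa-top ra-top ins (proj₁ cyc) noRise

  admissible-down : ∀ {p p'} → Inserts p p' → Admissible p' → Admissible p
  admissible-down ins (cyc , noRise) =
    Cycles.cyclic-down s Q≡R Q-s R-s ins cyc , noDoubleRise-down ins noRise

module LastFirst (m : ℕ) = AdmissibleInsertion (penult m) (last m) (fromℕ m)
  (punchIn-penult≡last m) (punchIn-penult-top m) (punchIn-last-top m) (penult-top m) (last-top m)

module PenultFirst (m : ℕ) = AdmissibleInsertion (last m) (penult m) (fromℕ m)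
  (λ x x≢top → sym (punchIn-penult≡last m x x≢top)) (punchIn-last-top m) (punchIn-penult-top m)
  (last-top m) (penult-top m)

enumerates-two-images : ∀ {k l} {P : Word k → Set} {P' : Word l → Set} (f g : Word k → Word l) →
  (∀ {x y} → f x ≡ f y → x ≡ y) → (∀ {x y} → g x ≡ g y → x ≡ y) → (∀ x y → f x ≢ g y) →
  (∀ {x} → P x → P' (f x) × P' (g x)) →
  (∀ {y} → P' y → (∃ λ x → P x × f x ≡ y) ⊎ (∃ λ x → P x × g x ≡ y)) →
  ∀ {L} → Enumerates P L → Enumerates P' (map f L ++ map g L)
enumerates-two-images {P' = P'} f g f-inj g-inj f≢g images covered {L} (unique , members) =
  ++⁺ (map⁺ f-inj unique) (map⁺ g-inj unique) disjoint , λ y → sound y , complete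
  where
  disjoint : ∀ {y} → ¬ (y ∈ map f L × y ∈ map g L)
  disjoint (inF , inG) with ∈-map⁻ f inF | ∈-map⁻ g inG
  ... | x₁ , _ , refl | x₂ , _ , fx₁≡gx₂ = f≢g x₁ x₂ fx₁≡gx₂
  sound : ∀ y → y ∈ map f L ++ map g L → P' y
  sound y y∈ with ∈-++⁻ (map f L) y∈
  ... | inj₁ inF with ∈-map⁻ f inF
  ...   | x , x∈L , refl = proj₁ (images (proj₁ (members x) x∈L))
  sound y y∈ | inj₂ inG with ∈-map⁻ g inG
  ...   | x , x∈L , refl = proj₂ (images (proj₁ (members x) x∈L))
  complete : ∀ {y} → P' y → y ∈ map f L ++ map g L
  complete P'y with covered P'y
  ... | inj₁ (x , Px , refl) = ∈-++⁺ˡ (∈-map⁺ f (proj₂ (members x) Px))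
  ... | inj₂ (x , Px , refl) = ∈-++⁺ʳ (map f L) (∈-map⁺ g (proj₂ (members x) Px))

enumerates-cong : ∀ {k} {P P' : Word k → Set} → (∀ p → P p → P' p) → (∀ p → P' p → P p) →
  ∀ {L} → Enumerates P L → Enumerates P' L
enumerates-cong to from (unique , members) =
  unique , λ p → to p ∘ proj₁ (members p) , proj₂ (members p) ∘ from p

insertion-of-either-shape : ∀ m {p' : Word (suc (suc (suc m)))} → Admissible p' →
  (∃ λ p → Admissible p × LastFirst.insert m p ≡ p') ⊎ (∃ λ p → Admissible p × PenultFirst.insert m p ≡ p')
insertion-of-either-shape m {p'} adm with crossed-shape m p' adm
... | last-first first hole with LastFirst.extract m p' (proj₁ (proj₁ adm)) first hole
...   | p , ins = inj₁ (p , LastFirst.admissible-down m ins adm ,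
                        LastFirst.inserts-functional m (LastFirst.insert-inserts m p) ins)
insertion-of-either-shape m {p'} adm | penult-first first hole
  with PenultFirst.extract m p' (proj₁ (proj₁ adm)) first hole
...   | p , ins = inj₂ (p , PenultFirst.admissible-down m ins adm ,
                        PenultFirst.inserts-functional m (PenultFirst.insert-inserts m p) ins)

-- The two shapes are told apart by the first entry.
shapes-disjoint : ∀ m p₁ p₂ → LastFirst.insert m p₁ ≢ PenultFirst.insert m p₂
shapes-disjoint m p₁ p₂ e = penult≢last m (suc-injective (begin
  suc (penult m)                       ≡⟨ sym (Insertion.Inserts.first-step (PenultFirst.insert-inserts m p₂)) ⟩
  app (PenultFirst.insert m p₂) zero   ≡⟨ cong (λ w → app w zero) (sym e) ⟩
  app (LastFirst.insert m p₁) zero     ≡⟨ Insertion.Inserts.first-step (LastFirst.insert-inserts m p₁) ⟩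
  suc (last m)                         ∎))
  where open ≡-Reasoning

enumerates-singleton : ∀ {k} {P : Word k → Set} (w : Word k) → P w → (∀ p → P p → p ≡ w) →
  Enumerates P (w ∷ [])
enumerates-singleton w Pw only = All.[] AllPairs.∷ AllPairs.[] ,
  λ p → (λ { (here refl) → Pw }) , (λ Pp → here (only p Pp))

one-point : Word 1
one-point = zero ∷ []

one-point-admissible : Admissible one-point
one-point-admissible = ((λ {x} {y} _ → all-equal x y) , λ i j → 0 , all-equal i j) , λ { zero zero _ () }
  where
  all-equal : ∀ (x y : Fin 1) → x ≡ y
  all-equal zero zero = refl

only-one-point : ∀ (p : Word 1) → Admissible p → p ≡ one-point
only-one-point (zero ∷ []) _ = refl

-- Length 2: the transposition; the identity is not cyclic and the rest not injective.
transposition : Word 2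
transposition = suc zero ∷ zero ∷ []

transposition-admissible : Admissible transposition
transposition-admissible = (injective , connected) , noRise
  where
  injective : IsPerm transposition
  injective {zero} {zero} _ = refl
  injective {zero} {suc zero} ()
  injective {suc zero} {zero} ()
  injective {suc zero} {suc zero} _ = refl
  connected : ∀ (i j : Fin 2) → ∃ λ k → iter transposition k i ≡ j
  connected zero zero = 0 , refl
  connected zero (suc zero) = 1 , refl
  connected (suc zero) zero = 1 , refl
  connected (suc zero) (suc zero) = 0 , refl
  noRise : NoDoubleRise transposition
  noRise _ zero _ () _ _ _
  noRise _ (suc zero) zero _ () _ _
  noRise _ (suc zero) (suc zero) _ (s≤s ()) _ _

identity2-not-cyclic : ¬ IsCyclic (zero ∷ suc zero ∷ [])
identity2-not-cyclic (_ , connected) with connected zero (suc zero)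
... | k , e = 0≢1+n (trans (sym (fixed k)) e)
  where
  fixed : ∀ k → iter (zero ∷ suc zero ∷ []) k zero ≡ zero
  fixed zero = refl
  fixed (suc k) rewrite fixed k = refl

only-transposition : ∀ (p : Word 2) → Admissible p → p ≡ transposition
only-transposition (zero ∷ zero ∷ []) ((perm , _) , _) with perm {zero} {suc zero} refl
... | ()
only-transposition (suc zero ∷ suc zero ∷ []) ((perm , _) , _) with perm {zero} {suc zero} refl
... | ()
only-transposition (zero ∷ suc zero ∷ []) (cyc , _) = ⊥-elim (identity2-not-cyclic cyc)
only-transposition (suc zero ∷ zero ∷ []) _ = refl

admissible-count : ∀ m → ∃ λ (L : List (Word (suc m))) → Enumerates Admissible L × length L ≡ 2 ^ (m / 2)
admissible-count zero =
  one-point ∷ [] , enumerates-singleton one-point one-point-admissible only-one-point , refl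
admissible-count (suc zero) =
  transposition ∷ [] , enumerates-singleton transposition transposition-admissible only-transposition , refl
admissible-count (suc (suc m)) with admissible-count m
... | L , enum , len =
  map (LastFirst.insert m) L ++ map (PenultFirst.insert m) L ,
  enumerates-two-images (LastFirst.insert m) (PenultFirst.insert m)
    (LastFirst.insert-injective m) (PenultFirst.insert-injective m) (shapes-disjoint m)
    (λ adm → LastFirst.admissible-up m (LastFirst.insert-inserts m _) adm ,
             PenultFirst.admissible-up m (PenultFirst.insert-inserts m _) adm)
    (insertion-of-either-shape m) enum ,
  doubled
  where
  open ≡-Reasoning
  doubled : length (map (LastFirst.insert m) L ++ map (PenultFirst.insert m) L) ≡ 2 ^ (suc (suc m) / 2)
  doubled = begin
    length (map (LastFirst.insert m) L ++ map (PenultFirst.insert m) L)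
      ≡⟨ length-++ (map (LastFirst.insert m) L) ⟩
    length (map (LastFirst.insert m) L) + length (map (PenultFirst.insert m) L)
      ≡⟨ cong₂ _+_ (length-map (LastFirst.insert m) L) (length-map (PenultFirst.insert m) L) ⟩
    length L + length L
      ≡⟨ cong₂ _+_ len (trans len (sym (ℕP.+-identityʳ _))) ⟩
    2 ^ (1 + m / 2)
      ≡⟨ cong (2 ^_) (sym (m/n≡1+[m∸n]/n {suc (suc m)} {2} (s≤s (s≤s z≤n)))) ⟩
    2 ^ (suc (suc m) / 2) ∎

admissible⇔avoids : ∀ {n} (p : Word n) →
  (Admissible p → IsCyclic p × Avoids p pattern123 × Avoids p pattern132) ×
  (IsCyclic p × Avoids p pattern123 × Avoids p pattern132 → Admissible p)
admissible⇔avoids p =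
  (λ (cyc , noRise) → cyc , noDoubleRise⇒avoids p pattern123 (s≤s z≤n) (s≤s z≤n) noRise
                          , noDoubleRise⇒avoids p pattern132 (s≤s z≤n) (s≤s z≤n) noRise) ,
  (λ (cyc , avoid123 , avoid132) → cyc , avoids⇒noDoubleRise p (proj₁ cyc) avoid123 avoid132)

theorem19 : ∀ (n : ℕ) → 3 ≤ n →
    ∃ λ (L : List (Word n)) →
    Enumerates (λ p → IsCyclic p × Avoids p (zero ∷ suc zero ∷ suc (suc zero) ∷ [])
    × Avoids p (zero ∷ suc (suc zero) ∷ suc zero ∷ []))
    L
    × length L ≡ 2 ^ ((n ∸ 1) / 2)
theorem19 zero ()
theorem19 (suc m) _ with admissible-count m
... | L , enum , len =
  L , enumerates-cong (proj₁ ∘ admissible⇔avoids) (proj₂ ∘ admissible⇔avoids) enum , len
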